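{- Let $m\ge 3$ and let $X_0=\{x_1,\dots,x_m\}$ be a set of positive integers forming a $10$-lacunary sequence, i.e. $x_{i+1}/x_i\ge 10$ for $i=1,\dots,m-1$. For $k=1,2,\dots,\lfloor m/3\rfloor$ let $$X_k=\big(X_0\setminus\{x_{3i}\}_{i=1}^{k}\big)\cup\{x'_{3i}\}_{i=1}^{k},\qquad x'_{3i}=2x_{3i-1}-x_{3i-2}.$$ Then $E(X_k)-E(X_{k-1})=4$ for every $k=1,\dots,\lfloor m/3\rfloor$.
   Context: For a finite set $A\subseteq\mathbb{Z}$, the additive energy is $E(A):=|\{(a_1,a_2,a_3,a_4)\in A^4:\ a_1+a_2=a_3+a_4\}|$. -}

module Defs where

open import Data.Nat as ℕ using (ℕ; suc; _∸_)
open import Data.Integer as ℤ using (ℤ; +_; _+_; _-_; _*_)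
open import Data.List using (List; []; _∷_; _++_; map; filter; length; upTo; concatMap; deduplicate; any)
open import Data.List.Relation.Unary.Any using (any?)
open import Data.Product using (_×_; _,_)
open import Relation.Nullary using (¬?)

quadruples : List ℤ → List (ℤ × ℤ × ℤ × ℤ)
quadruples A = concatMap (λ a → concatMap (λ b → concatMap (λ c → map (λ d → (a , b , c , d)) A) A) A) A

E : List ℤ → ℕ
E L = length (filter (λ { (a , b , c , d) → (a + b) ℤ.≟ (c + d) }) (quadruples (deduplicate ℤ._≟_ L)))

indices : ℕ → List ℕ
indices m = map suc (upTo m)

removedIdx : ℕ → List ℕ
removedIdx k = map (λ i → 3 ℕ.* suc i) (upTo k)

x′ : (ℕ → ℕ) → ℕ → ℤ
x′ x i = (+ 2) * (+ x (3 ℕ.* i ∸ 1)) - (+ x (3 ℕ.* i ∸ 2))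

Xk : ℕ → (ℕ → ℕ) → ℕ → List ℤ
Xk m x k =
  map (λ j → + x j) (filter (λ j → ¬? (any? (j ℕ.≟_) (removedIdx k))) (indices m))
  ++ map (λ i → x′ x (suc i)) (upTo k)

-- Order X_k decreasingly and build it from the bottom up. Adding a new maximum t to a finite set A raises
-- the energy by 1 + 4|A| + 4ρ, where ρ counts the solutions of t + b = c + d with b, c, d ∈ A. Along a
-- 10-lacunary sequence every new x_j is larger than all pair sums below it, so ρ = 0; the replacement
-- x'_{3i} = 2x_{3i-1} - x_{3i-2} has exactly the one solution x'_{3i} + x_{3i-2} = x_{3i-1} + x_{3i-1}, so ρ = 1.
-- Hence E(X_k) = (2m² - m) + 4k whenever 3k ≤ m, and each replacement adds exactly 4.
module Submission where

open import Defs
open import Data.Nat using (ℕ; zero; suc; _+_; _*_; _∸_; _≤_; _<_; _/_; z≤n; s≤s; NonZero)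
open import Data.Nat.Properties
open import Data.Nat.DivMod using (m/n*n≤m)
open import Data.Nat.Divisibility using (_∣_; divides; ∣⇒≤; ∣m+n∣m⇒∣n; m∣m*n)
open import Data.Nat.Tactic.RingSolver using (solve-∀)
open import Data.Integer using (ℤ) renaming (+_ to toℤ)
import Data.Integer as ℤ
import Data.Integer.Properties as ℤ
open import Data.List using (List; []; _∷_; _++_; length; map; filter; concatMap; deduplicate; downFrom; upTo)
open import Data.List.Properties using (length-map; length-++; length-upTo; length-downFrom; filter-++)
open import Data.List.Membership.Propositional using (_∈_; _∉_)
open import Data.List.Membership.Propositional.Properties
  using (∈-map⁺; ∈-map⁻; ∈-upTo⁺; ∈-upTo⁻; ∈-downFrom⁺; ∈-downFrom⁻; ∈-deduplicate⁺; ∈-deduplicate⁻;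
         ∈-++⁺ˡ; ∈-++⁺ʳ; ∈-++⁻; ∈-filter⁺; ∈-filter⁻)
open import Data.List.Relation.Binary.Subset.Propositional using (_⊆_)
open import Data.List.Relation.Unary.Any using (here; there)
import Data.List.Relation.Unary.All as All
import Data.List.Relation.Unary.Unique.Propositional.Properties as Unique
open import Data.List.Relation.Unary.Unique.DecPropositional.Properties using (deduplicate-!)
open import Data.List.Relation.Unary.Unique.Propositional using (Unique; []; _∷_)
open import Data.Sum using (inj₁; inj₂)
open import Data.Product using (_×_; _,_; proj₁; proj₂; ∃-syntax)
open import Function.Base using (_∘_)
open import Function.Bundles using (_⇔_; mk⇔; Equivalence)
open import Relation.Binary.Definitions using (DecidableEquality)
open import Relation.Binary.PropositionalEquality
open import Relation.Nullary using (Dec; yes; no; ¬_; contradiction)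
open import Relation.Unary using (Decidable)

𝟙 : ∀ {p} {P : Set p} → Dec P → ℕ
𝟙 (yes _) = 1
𝟙 (no _)  = 0

𝟙-yes : ∀ {p} {P : Set p} (P? : Dec P) → P → 𝟙 P? ≡ 1
𝟙-yes (yes _) _  = refl
𝟙-yes (no ¬p) p = contradiction p ¬p

𝟙-no : ∀ {p} {P : Set p} (P? : Dec P) → ¬ P → 𝟙 P? ≡ 0
𝟙-no (yes p) ¬p = contradiction p ¬p
𝟙-no (no _)  _  = refl

𝟙-cong : ∀ {p q} {P : Set p} {Q : Set q} (P? : Dec P) (Q? : Dec Q) → P ⇔ Q → 𝟙 P? ≡ 𝟙 Q?
𝟙-cong (yes _) (yes _) _   = refl
𝟙-cong (yes p) (no ¬q) P⇔Q = contradiction (Equivalence.to P⇔Q p) ¬q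
𝟙-cong (no ¬p) (yes q) P⇔Q = contradiction (Equivalence.from P⇔Q q) ¬p
𝟙-cong (no _)  (no _)  _   = refl

module _ {A : Set} where

  ∑ : List A → (A → ℕ) → ℕ
  ∑ []       g = 0
  ∑ (x ∷ xs) g = g x + ∑ xs g

  syntax ∑ xs (λ x → e) = ∑[ x ∈ xs ] e

  ∑-distrib-+ : ∀ xs (g h : A → ℕ) → ∑[ x ∈ xs ] (g x + h x) ≡ ∑ xs g + ∑ xs h
  ∑-distrib-+ []       g h = refl
  ∑-distrib-+ (x ∷ xs) g h = begin
    g x + h x + ∑[ y ∈ xs ] (g y + h y) ≡⟨ cong (g x + h x +_) (∑-distrib-+ xs g h) ⟩
    g x + h x + (∑ xs g + ∑ xs h)       ≡⟨ interchange (g x) (h x) (∑ xs g) (∑ xs h) ⟩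
    g x + ∑ xs g + (h x + ∑ xs h)       ∎
    where
    open ≡-Reasoning
    interchange : ∀ a b c d → a + b + (c + d) ≡ a + c + (b + d)
    interchange = solve-∀

  ∑-cong : ∀ xs {g h : A → ℕ} → (∀ {x} → x ∈ xs → g x ≡ h x) → ∑ xs g ≡ ∑ xs h
  ∑-cong []       _   = refl
  ∑-cong (x ∷ xs) g≗h = cong₂ _+_ (g≗h (here refl)) (∑-cong xs (g≗h ∘ there))

  ∑-const : ∀ xs {g : A → ℕ} c → (∀ {x} → x ∈ xs → g x ≡ c) → ∑ xs g ≡ length xs * c
  ∑-const []       c _    = refl
  ∑-const (x ∷ xs) c g≡c = cong₂ _+_ (g≡c (here refl)) (∑-const xs c (λ x∈ → g≡c (there x∈)))

  ∑-zero : ∀ xs {g : A → ℕ} → (∀ {x} → x ∈ xs → g x ≡ 0) → ∑ xs g ≡ 0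
  ∑-zero xs g≡0 = trans (∑-const xs 0 g≡0) (*-zeroʳ (length xs))

  ∑-single : ∀ {xs} {g : A → ℕ} {u} → Unique xs → u ∈ xs →
             (∀ {x} → x ∈ xs → x ≢ u → g x ≡ 0) → ∑ xs g ≡ g u
  ∑-single {x ∷ xs} {g} (x∉xs ∷ _) (here refl) g≡0 = begin
    g x + ∑ xs g ≡⟨ cong (g x +_) (∑-zero xs (λ y∈ → g≡0 (there y∈) (All.lookup x∉xs y∈ ∘ sym))) ⟩
    g x + 0      ≡⟨ +-identityʳ (g x) ⟩
    g x          ∎
    where
    open ≡-Reasoning
  ∑-single {x ∷ _} (x∉xs ∷ xs!) (there u∈) g≡0 =
    cong₂ _+_ (g≡0 (here refl) (All.lookup x∉xs u∈)) (∑-single xs! u∈ (λ y∈ → g≡0 (there y∈)))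

  ∑-comm : ∀ xs ys (f : A → A → ℕ) → ∑[ x ∈ xs ] ∑[ y ∈ ys ] f x y ≡ ∑[ y ∈ ys ] ∑[ x ∈ xs ] f x y
  ∑-comm []       ys f = sym (∑-zero ys (λ _ → refl))
  ∑-comm (x ∷ xs) ys f =
    trans (cong (∑ ys (f x) +_) (∑-comm xs ys f)) (sym (∑-distrib-+ ys (f x) _))

∑-map : ∀ {A B : Set} (h : A → B) xs (g : B → ℕ) → ∑ (map h xs) g ≡ ∑[ x ∈ xs ] g (h x)
∑-map h []       g = refl
∑-map h (x ∷ xs) g = cong (g (h x) +_) (∑-map h xs g)

∑-𝟙-unique : ∀ {A : Set} {P : A → Set} (P? : ∀ x → Dec (P x)) {xs u} → Unique xs → u ∈ xs → P u →
             (∀ {x} → x ∈ xs → P x → x ≡ u) → ∑[ x ∈ xs ] 𝟙 (P? x) ≡ 1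
∑-𝟙-unique P? xs! u∈xs Pu unique =
  trans (∑-single xs! u∈xs (λ x∈ x≢u → 𝟙-no (P? _) (x≢u ∘ unique x∈))) (𝟙-yes (P? _) Pu)

∑-𝟙-none : ∀ {A : Set} {P : A → Set} (P? : ∀ x → Dec (P x)) {xs} →
           (∀ {x} → x ∈ xs → ¬ P x) → ∑[ x ∈ xs ] 𝟙 (P? x) ≡ 0
∑-𝟙-none P? {xs} none = ∑-zero xs (λ x∈ → 𝟙-no (P? _) (none x∈))

module _ {A : Set} (_≟_ : DecidableEquality A) where

  δ : A → A → ℕ
  δ x y = 𝟙 (x ≟ y)

  δ-swap : ∀ (g : A → ℕ) x y → δ x y * g y ≡ δ y x * g x
  δ-swap g x y with x ≟ y | y ≟ x
  ... | yes refl | yes _   = refl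
  ... | yes refl | no y≢x  = contradiction refl y≢x
  ... | no x≢y   | yes y≡x = contradiction (sym y≡x) x≢y
  ... | no _     | no _    = refl

  ∑-δ : ∀ {ys x} (g : A → ℕ) → Unique ys → x ∈ ys → ∑[ y ∈ ys ] (δ x y * g y) ≡ g x
  ∑-δ {ys} {x} g ys! x∈ys = begin
    ∑[ y ∈ ys ] (δ x y * g y) ≡⟨ ∑-single ys! x∈ys (λ {y} _ y≢x → cong (_* g y) (𝟙-no (x ≟ y) (y≢x ∘ sym))) ⟩
    δ x x * g x               ≡⟨ cong (_* g x) (𝟙-yes (x ≟ x) refl) ⟩
    g x + 0                   ≡⟨ +-identityʳ (g x) ⟩
    g x                       ∎
    where open ≡-Reasoning

  ∑-δ′ : ∀ {xs y} (g : A → ℕ) → Unique xs → y ∈ xs → ∑[ x ∈ xs ] (δ x y * g y) ≡ g y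
  ∑-δ′ {xs} {y} g xs! y∈xs = trans (∑-cong xs (λ {x} _ → δ-swap g x y)) (∑-δ g xs! y∈xs)

  ∑-cong-members : ∀ {xs ys} (g : A → ℕ) → Unique xs → Unique ys → xs ⊆ ys → ys ⊆ xs → ∑ xs g ≡ ∑ ys g
  ∑-cong-members {xs} {ys} g xs! ys! xs⊆ys ys⊆xs = begin
    ∑ xs g                                   ≡⟨ ∑-cong xs (λ x∈ → sym (∑-δ g ys! (xs⊆ys x∈))) ⟩
    ∑[ x ∈ xs ] ∑[ y ∈ ys ] (δ x y * g y)    ≡⟨ ∑-comm xs ys (λ x y → δ x y * g y) ⟩
    ∑[ y ∈ ys ] ∑[ x ∈ xs ] (δ x y * g y)    ≡⟨ ∑-cong ys (λ y∈ → ∑-δ′ g xs! (ys⊆xs y∈)) ⟩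
    ∑ ys g                                   ∎
    where open ≡-Reasoning

  open import Data.List.Membership.DecPropositional _≟_ using (_∈?_)

  ∑-𝟙-∈ : ∀ {xs ys} → Unique xs → Unique ys → ys ⊆ xs → ∑[ x ∈ xs ] 𝟙 (x ∈? ys) ≡ length ys
  ∑-𝟙-∈ {xs} {ys} xs! ys! ys⊆xs = begin
    ∑[ x ∈ xs ] 𝟙 (x ∈? ys)                ≡⟨ ∑-cong xs (λ {x} _ → membership x) ⟩
    ∑[ x ∈ xs ] ∑[ y ∈ ys ] (δ x y * 1)    ≡⟨ ∑-comm xs ys (λ x y → δ x y * 1) ⟩
    ∑[ y ∈ ys ] ∑[ x ∈ xs ] (δ x y * 1)    ≡⟨ ∑-const ys 1 (λ y∈ → ∑-δ′ (λ _ → 1) xs! (ys⊆xs y∈)) ⟩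
    length ys * 1                          ≡⟨ *-identityʳ (length ys) ⟩
    length ys                              ∎
    where
    open ≡-Reasoning
    membership : ∀ x → 𝟙 (x ∈? ys) ≡ ∑[ y ∈ ys ] (δ x y * 1)
    membership x with x ∈? ys
    ... | yes x∈ys = sym (∑-δ (λ _ → 1) ys! x∈ys)
    ... | no x∉ys  = sym (∑-zero ys (λ {y} y∈ → cong (_* 1) (𝟙-no (x ≟ y) (λ { refl → x∉ys y∈ }))))

module _ {A : Set} where

  ∑² : List A → (A → A → ℕ) → ℕ
  ∑² xs F = ∑[ a ∈ xs ] ∑[ b ∈ xs ] F a b

  ∑⁴ : List A → (A → A → A → A → ℕ) → ℕ
  ∑⁴ xs F = ∑² xs (λ a b → ∑² xs (F a b))

  ∑²-∷ : ∀ t xs F → ∑² (t ∷ xs) F ≡ F t t + ∑ xs (F t) + (∑[ a ∈ xs ] F a t + ∑² xs F)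
  ∑²-∷ t xs F = cong (F t t + ∑ xs (F t) +_) (∑-distrib-+ xs (λ a → F a t) (λ a → ∑ xs (F a)))

  ∑²-cong : ∀ xs {F G : A → A → ℕ} → (∀ a b → F a b ≡ G a b) → ∑² xs F ≡ ∑² xs G
  ∑²-cong xs F≡G = ∑-cong xs (λ {a} _ → ∑-cong xs (λ {b} _ → F≡G a b))

  ∑²-distrib-+ : ∀ xs (F G : A → A → ℕ) → ∑² xs (λ a b → F a b + G a b) ≡ ∑² xs F + ∑² xs G
  ∑²-distrib-+ xs F G = trans (∑-cong xs (λ {a} _ → ∑-distrib-+ xs (F a) (G a))) (∑-distrib-+ xs _ _)

  ∑³-rotate : ∀ xs (F : A → A → A → ℕ) →
              ∑[ a ∈ xs ] ∑[ b ∈ xs ] ∑[ c ∈ xs ] F a b c ≡ ∑[ c ∈ xs ] ∑[ a ∈ xs ] ∑[ b ∈ xs ] F a b c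
  ∑³-rotate xs F = trans (∑-cong xs (λ {a} _ → ∑-comm xs xs (F a))) (∑-comm xs xs (λ a c → ∑[ b ∈ xs ] F a b c))

∑⁴-map : ∀ {A B : Set} (h : A → B) xs (F : B → B → B → B → ℕ) →
         ∑⁴ (map h xs) F ≡ ∑⁴ xs (λ a b c d → F (h a) (h b) (h c) (h d))
∑⁴-map h xs F =
  trans (∑-map h xs _) (∑-cong xs (λ _ → trans (∑-map h xs _) (∑-cong xs (λ _ →
  trans (∑-map h xs _) (∑-cong xs (λ _ → ∑-map h xs _))))))

∑⁴-cong-members : ∀ {A : Set} (_≟_ : DecidableEquality A) {xs ys} (F : A → A → A → A → ℕ) →
                  Unique xs → Unique ys → xs ⊆ ys → ys ⊆ xs → ∑⁴ xs F ≡ ∑⁴ ys F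
∑⁴-cong-members _≟_ {xs} {ys} F xs! ys! xs⊆ys ys⊆xs =
  trans (same _) (∑-cong ys (λ _ → trans (same _) (∑-cong ys (λ _ →
  trans (same _) (∑-cong ys (λ _ → same _))))))
  where
  same : ∀ g → ∑ xs g ≡ ∑ ys g
  same g = ∑-cong-members _≟_ g xs! ys! xs⊆ys ys⊆xs

module _ {A B : Set} {P : B → Set} (P? : Decidable P) where

  length-filter-concatMap : ∀ (g : A → List B) xs →
    length (filter P? (concatMap g xs)) ≡ ∑[ x ∈ xs ] length (filter P? (g x))
  length-filter-concatMap g []       = refl
  length-filter-concatMap g (x ∷ xs) = begin
    length (filter P? (g x ++ concatMap g xs))             ≡⟨ cong length (filter-++ P? (g x) (concatMap g xs)) ⟩
    length (filter P? (g x) ++ filter P? (concatMap g xs)) ≡⟨ length-++ (filter P? (g x)) ⟩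
    length (filter P? (g x)) + length (filter P? (concatMap g xs))
                                                          ≡⟨ cong (length (filter P? (g x)) +_) (length-filter-concatMap g xs) ⟩
    length (filter P? (g x)) + ∑[ y ∈ xs ] length (filter P? (g y)) ∎
    where open ≡-Reasoning

  length-filter-map : ∀ (h : A → B) xs → length (filter P? (map h xs)) ≡ ∑[ x ∈ xs ] 𝟙 (P? (h x))
  length-filter-map h []       = refl
  length-filter-map h (x ∷ xs) with P? (h x)
  ... | yes _ = cong suc (length-filter-map h xs)
  ... | no _  = length-filter-map h xs

sameSum : ℕ → ℕ → ℕ → ℕ → ℕ
sameSum a b c d = 𝟙 (a + b ≟ c + d)

energy : List ℕ → ℕ
energy A = ∑⁴ A sameSum

representations : ℕ → List ℕ → ℕ
representations t A = ∑[ b ∈ A ] ∑[ c ∈ A ] ∑[ d ∈ A ] sameSum t b c d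

E-as-∑⁴ : ∀ L → E L ≡ ∑⁴ (deduplicate ℤ._≟_ L) (λ a b c d → 𝟙 (a ℤ.+ b ℤ.≟ c ℤ.+ d))
E-as-∑⁴ L =
  trans (length-filter-concatMap _ _ D) (∑-cong D (λ _ →
  trans (length-filter-concatMap _ _ D) (∑-cong D (λ _ →
  trans (length-filter-concatMap _ _ D) (∑-cong D (λ _ → length-filter-map _ _ D))))))
  where
  D : List ℤ
  D = deduplicate ℤ._≟_ L

E-of-image : ∀ {L A} → Unique A → L ⊆ map toℤ A → map toℤ A ⊆ L → E L ≡ energy A
E-of-image {L} {A} A! L⊆A ⊆L = begin
  E L
    ≡⟨ E-as-∑⁴ L ⟩
  ∑⁴ (deduplicate ℤ._≟_ L) sameSumℤ
    ≡⟨ ∑⁴-cong-members ℤ._≟_ sameSumℤ (deduplicate-! ℤ._≟_ L) (Unique.map⁺ ℤ.+-injective A!)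
                       (L⊆A ∘ ∈-deduplicate⁻ ℤ._≟_ L) (∈-deduplicate⁺ ℤ._≟_ ∘ ⊆L) ⟩
  ∑⁴ (map toℤ A) sameSumℤ
    ≡⟨ ∑⁴-map toℤ A sameSumℤ ⟩
  ∑⁴ A (λ a b c d → sameSumℤ (toℤ a) (toℤ b) (toℤ c) (toℤ d))
    ≡⟨ ∑-cong A (λ {a} _ → ∑-cong A (λ {b} _ → ∑-cong A (λ {c} _ → ∑-cong A (λ {d} _ →
         𝟙-cong _ (a + b ≟ c + d) (mk⇔ ℤ.+-injective (cong toℤ)))))) ⟩
  energy A ∎
  where
  open ≡-Reasoning
  sameSumℤ : ℤ → ℤ → ℤ → ℤ → ℕ
  sameSumℤ a b c d = 𝟙 (a ℤ.+ b ℤ.≟ c ℤ.+ d)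

representations-slot₂ : ∀ t A → ∑[ a ∈ A ] ∑² A (sameSum a t) ≡ representations t A
representations-slot₂ t A = ∑-cong A (λ {a} _ → ∑-cong A (λ {c} _ → ∑-cong A (λ {d} _ →
  𝟙-cong (a + t ≟ c + d) (t + a ≟ c + d) (mk⇔ (trans (+-comm t a)) (trans (+-comm a t))))))

representations-slot₃ : ∀ t A → ∑² A (λ a b → ∑[ d ∈ A ] sameSum a b t d) ≡ representations t A
representations-slot₃ t A = trans (∑³-rotate A (λ a b d → sameSum a b t d))
  (∑-cong A (λ {d} _ → ∑-cong A (λ {a} _ → ∑-cong A (λ {b} _ →
    𝟙-cong (a + b ≟ t + d) (t + d ≟ a + b) (mk⇔ sym sym)))))

representations-slot₄ : ∀ t A → ∑² A (λ a b → ∑[ c ∈ A ] sameSum a b c t) ≡ representations t A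
representations-slot₄ t A = trans (∑³-rotate A (λ a b c → sameSum a b c t))
  (∑-cong A (λ {c} _ → ∑-cong A (λ {a} _ → ∑-cong A (λ {b} _ →
    𝟙-cong (a + b ≟ c + t) (t + c ≟ a + b) (mk⇔ (λ e → trans (+-comm t c) (sym e)) (λ e → trans (sym e) (+-comm t c)))))))

energy-∷ : ∀ {t A} → Unique A → t ∉ A → (∀ {a b} → a ∈ A → b ∈ A → a + b ≢ t + t) →
           energy (t ∷ A) ≡ energy A + (1 + 4 * length A + 4 * representations t A)
energy-∷ {t} {A} A! t∉A no-midpoint = begin
  energy (t ∷ A)
    ≡⟨ ∑²-cong (t ∷ A) split ⟩
  ∑² (t ∷ A) (λ a b → G a b + H a b)
    ≡⟨ ∑²-distrib-+ (t ∷ A) G H ⟩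
  ∑² (t ∷ A) G + ∑² (t ∷ A) H
    ≡⟨ cong₂ _+_ (∑²-∷ t A G) (∑²-∷ t A H) ⟩
  G t t + ∑ A (G t) + (∑[ a ∈ A ] G a t + ∑² A G) + (H t t + ρ + (∑[ a ∈ A ] H a t + energy A))
    ≡⟨ cong₂ _+_ (cong₂ _+_ (cong₂ _+_ Gtt (∑-const A 2 Gtb)) (cong₂ _+_ (∑-const A 2 Gat) ∑²G))
                 (cong₂ _+_ (cong (_+ ρ) Htt) (cong (_+ energy A) (representations-slot₂ t A))) ⟩
  1 + length A * 2 + (length A * 2 + (0 + ρ + ρ)) + (0 + ρ + (ρ + energy A))
    ≡⟨ collect (length A) ρ (energy A) ⟩
  energy A + (1 + 4 * length A + 4 * ρ) ∎
  where
  open ≡-Reasoning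
  ρ : ℕ
  ρ = representations t A
  G H : ℕ → ℕ → ℕ
  G a b = sameSum a b t t + ∑[ d ∈ A ] sameSum a b t d + ∑[ c ∈ A ] sameSum a b c t
  H a b = ∑² A (sameSum a b)

  split : ∀ a b → ∑² (t ∷ A) (sameSum a b) ≡ G a b + H a b
  split a b = trans (∑²-∷ t A (sameSum a b))
    (sym (+-assoc (sameSum a b t t + ∑ A (sameSum a b t)) (∑[ c ∈ A ] sameSum a b c t) (H a b)))

  ≢t : ∀ {a} → a ∈ A → a ≢ t
  ≢t a∈ refl = t∉A a∈

  Gtt : G t t ≡ 1
  Gtt = cong₂ _+_
    (cong₂ _+_ (𝟙-yes (t + t ≟ t + t) refl)
               (∑-𝟙-none (λ d → t + t ≟ t + d) (λ d∈ e → ≢t d∈ (sym (+-cancelˡ-≡ t _ _ e)))))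
    (∑-𝟙-none (λ c → t + t ≟ c + t) (λ c∈ e → ≢t c∈ (sym (+-cancelʳ-≡ t _ _ e))))

  Gtb : ∀ {b} → b ∈ A → G t b ≡ 2
  Gtb {b} b∈ = cong₂ _+_
    (cong₂ _+_ (𝟙-no (t + b ≟ t + t) (≢t b∈ ∘ +-cancelˡ-≡ t _ _))
               (∑-𝟙-unique (λ d → t + b ≟ t + d) A! b∈ refl (λ _ e → sym (+-cancelˡ-≡ t _ _ e))))
    (∑-𝟙-unique (λ c → t + b ≟ c + t) A! b∈ (+-comm t b) (λ _ e → sym (+-cancelˡ-≡ t _ _ (trans e (+-comm _ t)))))

  Gat : ∀ {a} → a ∈ A → G a t ≡ 2
  Gat {a} a∈ = cong₂ _+_
    (cong₂ _+_ (𝟙-no (a + t ≟ t + t) (≢t a∈ ∘ +-cancelʳ-≡ t _ _))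
               (∑-𝟙-unique (λ d → a + t ≟ t + d) A! a∈ (+-comm a t) (λ _ e → sym (+-cancelʳ-≡ t _ _ (trans e (+-comm t _))))))
    (∑-𝟙-unique (λ c → a + t ≟ c + t) A! a∈ refl (λ _ e → sym (+-cancelʳ-≡ t _ _ e)))

  Htt : H t t ≡ 0
  Htt = ∑-zero A (λ c∈ → ∑-𝟙-none (λ d → t + t ≟ _ + d) (λ d∈ e → no-midpoint c∈ d∈ (sym e)))

  ∑²G : ∑² A G ≡ 0 + ρ + ρ
  ∑²G = begin
    ∑² A G
      ≡⟨ trans (∑²-distrib-+ A _ _) (cong (_+ ∑² A (λ a b → ∑[ c ∈ A ] sameSum a b c t)) (∑²-distrib-+ A _ _)) ⟩
    ∑² A (λ a b → sameSum a b t t) + ∑² A (λ a b → ∑[ d ∈ A ] sameSum a b t d)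
                                   + ∑² A (λ a b → ∑[ c ∈ A ] sameSum a b c t)
      ≡⟨ cong₂ _+_ (cong₂ _+_ no-midpoints (representations-slot₃ t A)) (representations-slot₄ t A) ⟩
    0 + ρ + ρ ∎
    where
    no-midpoints : ∑² A (λ a b → sameSum a b t t) ≡ 0
    no-midpoints = ∑-zero A (λ a∈ → ∑-𝟙-none (λ b → _ + b ≟ t + t) (no-midpoint a∈))

  collect : ∀ n r e → 1 + n * 2 + (n * 2 + (0 + r + r)) + (0 + r + (r + e)) ≡ e + (1 + 4 * n + 4 * r)
  collect = solve-∀

energy-∷-above : ∀ {t A} → Unique A → (∀ {a} → a ∈ A → a < t) →
                 energy (t ∷ A) ≡ energy A + (1 + 4 * length A + 4 * representations t A)
energy-∷-above A! below =
  energy-∷ A! (λ t∈ → <-irrefl refl (below t∈)) (λ a∈ b∈ → <⇒≢ (+-mono-< (below a∈) (below b∈)))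

representations-small : ∀ {t A} → (∀ {c d} → c ∈ A → d ∈ A → c + d < t) → representations t A ≡ 0
representations-small {t} {A} small = ∑-zero A (λ {b} _ → ∑-zero A (λ {c} c∈ →
  ∑-𝟙-none (λ d → t + b ≟ c + d) (λ d∈ e → <⇒≱ (small c∈ d∈) (≤-trans (m≤m+n t b) (≤-reflexive e)))))

representations-unique : ∀ {t A b c d} → Unique A → b ∈ A → c ∈ A → d ∈ A → t + b ≡ c + d →
  (∀ {b′ c′ d′} → b′ ∈ A → c′ ∈ A → d′ ∈ A → t + b′ ≡ c′ + d′ → b′ ≡ b × c′ ≡ c × d′ ≡ d) →
  representations t A ≡ 1
representations-unique {t} {A} {b} {c} A! b∈ c∈ d∈ eq unique =
  trans (∑-single A! b∈ (λ b′∈ b′≢b → ∑-zero A (λ c′∈ →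
           ∑-𝟙-none _ (λ d′∈ e → b′≢b (proj₁ (unique b′∈ c′∈ d′∈ e))))))
  (trans (∑-single A! c∈ (λ c′∈ c′≢c → ∑-𝟙-none _ (λ d′∈ e → c′≢c (proj₁ (proj₂ (unique b∈ c′∈ d′∈ e))))))
         (∑-𝟙-unique _ A! d∈ eq (λ d′∈ e → proj₂ (proj₂ (unique b∈ c∈ d′∈ e)))))

-- A representation t + b′ = c + d forces c = d = a, since any other c ∈ a ∷ A′ has c + d ≤ c + a < t.
representations-reflection : ∀ {t a A′ b} → Unique (a ∷ A′) → b ∈ A′ → t + b ≡ a + a →
  (∀ {c} → c ∈ a ∷ A′ → c ≤ a) → (∀ {c} → c ∈ A′ → c + a < t) → representations t (a ∷ A′) ≡ 1
representations-reflection {t} {a} {A′} {b} A! b∈ eq ≤a far =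
  representations-unique A! (there b∈) (here refl) (here refl) eq unique
  where
  is-max : ∀ {b′ c d} → b′ ∈ a ∷ A′ → d ∈ a ∷ A′ → t + b′ ≡ c + d → c ∈ a ∷ A′ → c ≡ a
  is-max _  _  _ (here c≡a) = c≡a
  is-max {b′} {c} {d} _ d∈ e (there c∈) =
    contradiction (≤-trans (m≤m+n t b′) (≤-reflexive e)) (<⇒≱ (≤-<-trans (+-monoʳ-≤ c (≤a d∈)) (far c∈)))
  unique : ∀ {b′ c d} → b′ ∈ a ∷ A′ → c ∈ a ∷ A′ → d ∈ a ∷ A′ → t + b′ ≡ c + d → b′ ≡ b × c ≡ a × d ≡ a
  unique {b′} {c} {d} b′∈ c∈ d∈ e with is-max b′∈ d∈ e c∈ | is-max b′∈ c∈ (trans e (+-comm c d)) d∈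
  ... | refl | refl = +-cancelˡ-≡ t b′ b (trans e (sym eq)) , refl , refl

reflection-sum : ∀ {a b} → b ≤ 2 * a → (2 * a ∸ b) + b ≡ a + a
reflection-sum {a} b≤2a = trans (m∸n+n≡m b≤2a) (cong (a +_) (+-identityʳ a))

reflection-above : ∀ {a b} → b + b < a → b + a < 2 * a ∸ b
reflection-above {a} {b} 2b<a = m+n≤o⇒m≤o∸n (suc (b + a)) (begin
  suc (b + a) + b   ≡⟨ rearrange a b ⟩
  a + suc (b + b)   ≤⟨ +-monoʳ-≤ a 2b<a ⟩
  a + a             ≡⟨ cong (a +_) (sym (+-identityʳ a)) ⟩
  2 * a             ∎)
  where
  open ≤-Reasoning
  rearrange : ∀ a b → suc (b + a) + b ≡ a + suc (b + b)
  rearrange = solve-∀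

twice<ten-fold : ∀ {y} → 0 < y → y + y < 10 * y
twice<ten-fold {y@(suc _)} _ = <-≤-trans (m<m+n (y + y) {8 * y} (s≤s z≤n)) (≤-reflexive (regroup y))
  where
  regroup : ∀ y → y + y + 8 * y ≡ 10 * y
  regroup = solve-∀

open import Data.List.Membership.DecPropositional _≟_ using (_∈?_; _∉?_)

-- 2n² - n, the energy of an n-element Sidon set.
sidonEnergy : ℕ → ℕ
sidonEnergy zero    = 0
sidonEnergy (suc n) = sidonEnergy n + (1 + 4 * n)

element : (ℕ → ℕ) → ℕ → ℕ → ℕ
element x k j with j ∈? removedIdx k
... | yes _ = 2 * x (j ∸ 1) ∸ x (j ∸ 2)
... | no _  = x j

positions : ℕ → List ℕ
positions n = map suc (downFrom n)

-- The elements of X_k as naturals, listed from the largest down (see sorted-<).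
sorted : (ℕ → ℕ) → ℕ → ℕ → List ℕ
sorted x k n = map (element x k) (positions n)

∈-positions⁺ : ∀ {j n} → j < n → suc j ∈ positions n
∈-positions⁺ j<n = ∈-map⁺ suc (∈-downFrom⁺ j<n)

∈-positions⁻ : ∀ {j n} → j ∈ positions n → ∃[ i ] (i < n × j ≡ suc i)
∈-positions⁻ j∈ with ∈-map⁻ suc j∈
... | i , i∈ , j≡ = i , ∈-downFrom⁻ i∈ , j≡

positions-unique : ∀ n → Unique (positions n)
positions-unique n = Unique.map⁺ suc-injective (Unique.downFrom⁺ n)

positions⊆indices : ∀ {n} → positions n ⊆ indices n
positions⊆indices j∈ with ∈-positions⁻ j∈
... | i , i<n , refl = ∈-map⁺ suc (∈-upTo⁺ i<n)

indices⊆positions : ∀ {n} → indices n ⊆ positions n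
indices⊆positions j∈ with ∈-map⁻ suc j∈
... | i , i∈ , refl = ∈-positions⁺ (∈-upTo⁻ i∈)

element-removed : ∀ x k {j} → j ∈ removedIdx k → element x k j ≡ 2 * x (j ∸ 1) ∸ x (j ∸ 2)
element-removed x k {j} j∈ with j ∈? removedIdx k
... | yes _   = refl
... | no j∉ = contradiction j∈ j∉

element-kept : ∀ x k {j} → j ∉ removedIdx k → element x k j ≡ x j
element-kept x k {j} j∉ with j ∈? removedIdx k
... | yes j∈ = contradiction j∈ j∉
... | no _   = refl

removedIdx-form : ∀ {k j} → j ∈ removedIdx k → ∃[ i ] (i < k × j ≡ 3 * suc i)
removedIdx-form j∈ with ∈-map⁻ (λ i → 3 * suc i) j∈
... | i , i∈ , j≡ = i , ∈-upTo⁻ i∈ , j≡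

r+3i∉removedIdx : ∀ {k} i r .{{_ : NonZero r}} → r < 3 → r + 3 * i ∉ removedIdx k
r+3i∉removedIdx i r r<3 j∈ with removedIdx-form j∈
... | i′ , _ , j≡ = <⇒≱ r<3 (∣⇒≤ (∣m+n∣m⇒∣n 3∣3i+r (m∣m*n i)))
  where
  3∣3i+r : 3 ∣ 3 * i + r
  3∣3i+r = divides (suc i′) (trans (+-comm (3 * i) r) (trans j≡ (*-comm 3 (suc i′))))

removedIdx-unique : ∀ k → Unique (removedIdx k)
removedIdx-unique k = Unique.map⁺ (suc-injective ∘ *-cancelˡ-≡ _ _ 3) (Unique.upTo⁺ k)

removedIdx⊆positions : ∀ {k n} → 3 * k ≤ n → removedIdx k ⊆ positions n
removedIdx⊆positions {k} 3k≤n j∈ with removedIdx-form j∈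
... | i , i<k , j≡ with trans j≡ (*-suc 3 i)
... | refl = ∈-positions⁺ (≤-trans (≤-reflexive (sym (*-suc 3 i))) (≤-trans (*-monoʳ-≤ 3 i<k) 3k≤n))

removedIdx-count : ∀ {k n} → 3 * k ≤ n → ∑[ j ∈ positions n ] 𝟙 (j ∈? removedIdx k) ≡ k
removedIdx-count {k} {n} 3k≤n = begin
  ∑[ j ∈ positions n ] 𝟙 (j ∈? removedIdx k)
    ≡⟨ ∑-𝟙-∈ _≟_ (positions-unique n) (removedIdx-unique k) (removedIdx⊆positions 3k≤n) ⟩
  length (removedIdx k)
    ≡⟨ trans (length-map _ (upTo k)) (length-upTo k) ⟩
  k ∎
  where open ≡-Reasoning

toℤ-reflection : ∀ a b → b ≤ 2 * a → toℤ 2 ℤ.* toℤ a ℤ.- toℤ b ≡ toℤ (2 * a ∸ b)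
toℤ-reflection a b b≤2a = begin
  toℤ 2 ℤ.* toℤ a ℤ.- toℤ b ≡⟨ cong (ℤ._- toℤ b) (sym (ℤ.pos-* 2 a)) ⟩
  toℤ (2 * a) ℤ.- toℤ b      ≡⟨ ℤ.m-n≡m⊖n (2 * a) b ⟩
  (2 * a) ℤ.⊖ b              ≡⟨ ℤ.⊖-≥ b≤2a ⟩
  toℤ (2 * a ∸ b)            ∎
  where open ≡-Reasoning

module Lacunary (m : ℕ) (x : ℕ → ℕ)
                (pos : ∀ i → 1 ≤ i → i ≤ m → 0 < x i)
                (lac : ∀ i → 1 ≤ i → i < m → 10 * x i ≤ x (suc i)) (k : ℕ) where

  x+x<x[1+] : ∀ {n} → 1 ≤ n → n < m → x n + x n < x (suc n)
  x+x<x[1+] {n} 1≤n n<m = <-≤-trans (twice<ten-fold (pos n 1≤n (<⇒≤ n<m))) (lac n 1≤n n<m)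

  x≤x[1+] : ∀ {n} → 1 ≤ n → n < m → x n ≤ x (suc n)
  x≤x[1+] {n} 1≤n n<m = ≤-trans (m≤m+n (x n) (x n)) (<⇒≤ (x+x<x[1+] 1≤n n<m))

  x≤2x[1+] : ∀ {n} → 1 ≤ n → n < m → x n ≤ 2 * x (suc n)
  x≤2x[1+] {n} 1≤n n<m = ≤-trans (x≤x[1+] 1≤n n<m) (m≤m+n (x (suc n)) (x (suc n) + 0))

  element≤x : ∀ {j} → j ≤ m → element x k j ≤ x j
  element≤x {j} j≤m with j ∈? removedIdx k
  ... | no _ = ≤-refl
  ... | yes j∈ with removedIdx-form j∈
  ... | i , _ , j≡ with trans j≡ (*-suc 3 i)
  ... | refl = begin
    2 * x (2 + 3 * i) ∸ x (1 + 3 * i) ≤⟨ m∸n≤m (2 * x (2 + 3 * i)) (x (1 + 3 * i)) ⟩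
    2 * x (2 + 3 * i)                 ≤⟨ *-monoˡ-≤ (x (2 + 3 * i)) {2} {10} (s≤s (s≤s z≤n)) ⟩
    10 * x (2 + 3 * i)                ≤⟨ lac (2 + 3 * i) (s≤s z≤n) j≤m ⟩
    x (3 + 3 * i)                     ∎
    where open ≤-Reasoning

  x<element[1+] : ∀ {n} → 1 ≤ n → suc n ≤ m → x n < element x k (suc n)
  x<element[1+] {n} 1≤n n<m with suc n ∈? removedIdx k
  ... | no _ = ≤-<-trans (m≤m+n (x n) (x n)) (x+x<x[1+] 1≤n n<m)
  ... | yes j∈ with removedIdx-form j∈
  ... | i , _ , j≡ with trans j≡ (*-suc 3 i)
  ... | refl = ≤-<-trans (m≤n+m (x (2 + 3 * i)) (x (1 + 3 * i)))
                         (reflection-above {x (2 + 3 * i)} (x+x<x[1+] (s≤s z≤n) (≤-trans (n≤1+n _) n<m)))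

  sorted-≤ : ∀ {n c} → n ≤ m → c ∈ sorted x k n → c ≤ x n
  sorted-≤ {suc n}       n≤m (here refl) = element≤x n≤m
  sorted-≤ {suc zero}    _   (there ())
  sorted-≤ {suc (suc n)} n≤m (there c∈) =
    ≤-trans (sorted-≤ (≤-trans (n≤1+n _) n≤m) c∈) (x≤x[1+] (s≤s z≤n) n≤m)

  sorted-< : ∀ {n c} → suc n ≤ m → c ∈ sorted x k n → c < element x k (suc n)
  sorted-< {suc n} n<m c∈ = ≤-<-trans (sorted-≤ (≤-trans (n≤1+n _) n<m) c∈) (x<element[1+] (s≤s z≤n) n<m)

  sorted-unique : ∀ {n} → n ≤ m → Unique (sorted x k n)
  sorted-unique {zero}  _   = []
  sorted-unique {suc n} n<m =
    All.tabulate (λ c∈ → <⇒≢ (sorted-< n<m c∈) ∘ sym) ∷ sorted-unique (≤-trans (n≤1+n n) n<m)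

  length-sorted : ∀ n → length (sorted x k n) ≡ n
  length-sorted n = trans (length-map (element x k) (positions n))
                          (trans (length-map suc (downFrom n)) (length-downFrom n))

  sorted-pair-sums : ∀ {n c d} → suc n ≤ m → c ∈ sorted x k n → d ∈ sorted x k n → c + d < x (suc n)
  sorted-pair-sums {suc n} n<m c∈ d∈ =
    ≤-<-trans (+-mono-≤ (sorted-≤ n≤m c∈) (sorted-≤ n≤m d∈)) (x+x<x[1+] (s≤s z≤n) n<m)
    where n≤m = ≤-trans (n≤1+n _) n<m

  representations-element : ∀ {n} → suc n ≤ m →
    representations (element x k (suc n)) (sorted x k n) ≡ 𝟙 (suc n ∈? removedIdx k)
  representations-element {n} n<m with suc n ∈? removedIdx k
  ... | no _ = representations-small (sorted-pair-sums n<m)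
  ... | yes j∈ with removedIdx-form j∈
  ... | i , _ , j≡ with trans j≡ (*-suc 3 i)
  ... | refl = representations-reflection (sorted-unique n≤m) (here refl) reflection ≤a far
    where
    n≤m = ≤-trans (n≤1+n _) n<m
    a b : ℕ
    a = x (2 + 3 * i)
    b = x (1 + 3 * i)
    a-kept : element x k (2 + 3 * i) ≡ a
    a-kept = element-kept x k (r+3i∉removedIdx i 2 (s≤s (s≤s (s≤s z≤n))))
    b-kept : element x k (1 + 3 * i) ≡ b
    b-kept = element-kept x k (r+3i∉removedIdx i 1 (s≤s (s≤s z≤n)))
    2b<a : b + b < a
    2b<a = x+x<x[1+] (s≤s z≤n) (≤-trans (n≤1+n _) n<m)
    reflection : 2 * a ∸ b + element x k (1 + 3 * i) ≡ element x k (2 + 3 * i) + element x k (2 + 3 * i)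
    reflection rewrite a-kept | b-kept = reflection-sum {a} (x≤2x[1+] (s≤s z≤n) (≤-trans (n≤1+n _) n<m))
    ≤a : ∀ {c} → c ∈ sorted x k (2 + 3 * i) → c ≤ element x k (2 + 3 * i)
    ≤a c∈ = subst (_ ≤_) (sym a-kept) (sorted-≤ n≤m c∈)
    far : ∀ {c} → c ∈ sorted x k (1 + 3 * i) → c + element x k (2 + 3 * i) < 2 * a ∸ b
    far c∈ = subst (λ e → _ + e < 2 * a ∸ b) (sym a-kept)
               (≤-<-trans (+-monoˡ-≤ a (sorted-≤ (≤-trans (n≤1+n _) n≤m) c∈)) (reflection-above {a} {b} 2b<a))

  energy-sorted : ∀ {n} → n ≤ m →
    energy (sorted x k n) ≡ sidonEnergy n + 4 * ∑[ j ∈ positions n ] 𝟙 (j ∈? removedIdx k)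
  energy-sorted {zero}  _   = refl
  energy-sorted {suc n} n<m = begin
    energy (sorted x k (suc n))
      ≡⟨ energy-∷-above (sorted-unique n≤m) (sorted-< n<m) ⟩
    energy (sorted x k n) + (1 + 4 * length (sorted x k n) + 4 * representations (element x k (suc n)) (sorted x k n))
      ≡⟨ cong₂ _+_ (energy-sorted n≤m)
                   (cong₂ (λ l r → 1 + 4 * l + 4 * r) (length-sorted n) (representations-element n<m)) ⟩
    sidonEnergy n + 4 * removed n + (1 + 4 * n + 4 * 𝟙 (suc n ∈? removedIdx k))
      ≡⟨ regroup (sidonEnergy n) (removed n) n (𝟙 (suc n ∈? removedIdx k)) ⟩
    sidonEnergy n + (1 + 4 * n) + 4 * (𝟙 (suc n ∈? removedIdx k) + removed n) ∎
    where
    open ≡-Reasoning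
    n≤m = ≤-trans (n≤1+n n) n<m
    removed : ℕ → ℕ
    removed n = ∑[ j ∈ positions n ] 𝟙 (j ∈? removedIdx k)
    regroup : ∀ s r n e → s + 4 * r + (1 + 4 * n + 4 * e) ≡ s + (1 + 4 * n) + 4 * (e + r)
    regroup = solve-∀

  module _ (3k≤m : 3 * k ≤ m) where

    x′≡element : ∀ {i} → i < k → x′ x (suc i) ≡ toℤ (element x k (3 * suc i))
    x′≡element {i} i<k = trans (toℤ-reflection (x (3 * suc i ∸ 1)) _ b≤2a)
                              (cong toℤ (sym (element-removed x k (∈-map⁺ _ (∈-upTo⁺ i<k)))))
      where
      3[1+i]≤m : 3 + 3 * i ≤ m
      3[1+i]≤m = ≤-trans (≤-reflexive (sym (*-suc 3 i))) (≤-trans (*-monoʳ-≤ 3 i<k) 3k≤m)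
      b≤2a : x (3 * suc i ∸ 2) ≤ 2 * x (3 * suc i ∸ 1)
      b≤2a = subst (λ j → x (j ∸ 2) ≤ 2 * x (j ∸ 1)) (sym (*-suc 3 i))
               (x≤2x[1+] {1 + 3 * i} (s≤s z≤n) (≤-trans (n≤1+n _) 3[1+i]≤m))

    kept : List ℕ
    kept = filter (_∉? removedIdx k) (indices m)

    new∈Xk : ∀ {i} → i < k → x′ x (suc i) ∈ Xk m x k
    new∈Xk i<k = ∈-++⁺ʳ (map (λ j → toℤ (x j)) kept) (∈-map⁺ (λ i → x′ x (suc i)) (∈-upTo⁺ i<k))

    element∈sorted : ∀ {j} → j ∈ positions m → toℤ (element x k j) ∈ map toℤ (sorted x k m)
    element∈sorted j∈ = ∈-map⁺ toℤ (∈-map⁺ (element x k) j∈)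

    element∈Xk : ∀ {j} → j ∈ positions m → Dec (j ∈ removedIdx k) → toℤ (element x k j) ∈ Xk m x k
    element∈Xk j∈ (no j∉) = subst (_∈ Xk m x k) (cong toℤ (sym (element-kept x k j∉)))
      (∈-++⁺ˡ (∈-map⁺ (λ j → toℤ (x j)) (∈-filter⁺ (_∉? removedIdx k) (positions⊆indices j∈) j∉)))
    element∈Xk _ (yes j∈R) with removedIdx-form j∈R
    ... | i , i<k , refl = subst (_∈ Xk m x k) (x′≡element i<k) (new∈Xk i<k)

    sorted⊆Xk : map toℤ (sorted x k m) ⊆ Xk m x k
    sorted⊆Xk v∈ with ∈-map⁻ toℤ v∈
    ... | c , c∈ , refl with ∈-map⁻ (element x k) c∈
    ... | j , j∈ , refl = element∈Xk j∈ (j ∈? removedIdx k)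

    Xk⊆sorted : Xk m x k ⊆ map toℤ (sorted x k m)
    Xk⊆sorted v∈ with ∈-++⁻ (map (λ j → toℤ (x j)) kept) v∈
    ... | inj₁ v∈kept with ∈-map⁻ (λ j → toℤ (x j)) v∈kept
    ... | j , j∈ , refl with ∈-filter⁻ (_∉? removedIdx k) {xs = indices m} j∈
    ... | j∈indices , j∉ =
      subst (_∈ map toℤ (sorted x k m)) (cong toℤ (element-kept x k j∉))
            (element∈sorted (indices⊆positions j∈indices))
    Xk⊆sorted v∈ | inj₂ v∈new with ∈-map⁻ (λ i → x′ x (suc i)) v∈new
    ... | i , i∈ , refl =
      subst (_∈ map toℤ (sorted x k m)) (sym (x′≡element i<k))
            (element∈sorted (removedIdx⊆positions 3k≤m (∈-map⁺ _ (∈-upTo⁺ i<k))))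
      where i<k = ∈-upTo⁻ i∈

    E-Xk : E (Xk m x k) ≡ sidonEnergy m + 4 * k
    E-Xk = begin
      E (Xk m x k)
        ≡⟨ E-of-image (sorted-unique ≤-refl) Xk⊆sorted sorted⊆Xk ⟩
      energy (sorted x k m)
        ≡⟨ energy-sorted ≤-refl ⟩
      sidonEnergy m + 4 * ∑[ j ∈ positions m ] 𝟙 (j ∈? removedIdx k)
        ≡⟨ cong (λ r → sidonEnergy m + 4 * r) (removedIdx-count 3k≤m) ⟩
      sidonEnergy m + 4 * k ∎
      where open ≡-Reasoning

lemma2p2 : (m : ℕ) → 3 ≤ m → (x : ℕ → ℕ) →
    (∀ i → 1 ≤ i → i ≤ m → 0 < x i) →
    (∀ i → 1 ≤ i → i < m → 10 * x i ≤ x (suc i)) →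
    ∀ k → 1 ≤ k → k ≤ m / 3 →
    E (Xk m x k) ≡ E (Xk m x (k ∸ 1)) + 4
lemma2p2 m _ x pos lac (suc k) _ 1+k≤m/3 = begin
  E (Xk m x (suc k))        ≡⟨ Lacunary.E-Xk m x pos lac (suc k) 3[1+k]≤m ⟩
  sidonEnergy m + 4 * suc k ≡⟨ regroup (sidonEnergy m) k ⟩
  sidonEnergy m + 4 * k + 4 ≡⟨ cong (_+ 4) (Lacunary.E-Xk m x pos lac k 3k≤m) ⟨
  E (Xk m x k) + 4          ∎
  where
  open ≡-Reasoning
  3[1+k]≤m : 3 * suc k ≤ m
  3[1+k]≤m = ≤-trans (*-monoʳ-≤ 3 1+k≤m/3) (≤-trans (≤-reflexive (*-comm 3 (m / 3))) (m/n*n≤m m 3))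
  3k≤m : 3 * k ≤ m
  3k≤m = ≤-trans (*-monoʳ-≤ 3 (n≤1+n k)) 3[1+k]≤m
  regroup : ∀ s k → s + 4 * suc k ≡ s + 4 * k + 4
  regroup = solve-∀
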